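{- Let $n$ be an odd integer, let $d$ be a proper divisor of $n$ which is not a square, and let $n'=n/d$ with $\gcd(d,n')=1$. Let $f:\mathbb{Z}_n\to\mathbb{Z}_{n'}$ be the natural map. Then $U(n')\subseteq f(S(n))$.
   Context: $\mathbb{Z}_m=\mathbb{Z}/m\mathbb{Z}$, $U(m)$ its unit group; the natural map $\mathbb{Z}_n\to\mathbb{Z}_{n'}$ is reduction modulo $n'$. For odd $n=\prod p_i^{r_i}$ and $a\in U(n)$, the Jacobi symbol is $\left(\frac{a}{n}\right)=\prod_i\left(\frac{a\bmod p_i}{p_i}\right)^{r_i}$ (Legendre symbols), and $S(n)$ is the kernel of the homomorphism $U(n)\to\{1,-1\}$, $a\mapsto\left(\frac{a}{n}\right)$. -}

module Defs where

open import Data.Nat as ℕ using (ℕ; zero; suc; _<_; _%_)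
open import Data.Nat.Divisibility using (_∣_; _∣?_)
open import Data.Nat.Primality using (prime?)
open import Data.Nat.Coprimality using (Coprime)
open import Data.Integer as ℤ using (ℤ; +_; -_; _*_; _^_)
open import Data.List using (List; foldr; filter; length; map; upTo)
open import Data.Product using (Σ; _×_; _,_)
open import Relation.Nullary using (yes; no; ¬_)
open import Relation.Nullary.Decidable using (⌊_⌋)
open import Relation.Binary.PropositionalEquality using (_≡_)
open import Data.List.Relation.Unary.Any using (any?)
open import Data.Nat.Properties using (_≟_)

-- Elements of Z_m are represented by their canonical residues a ∈ {0,…,m-1}.
-- U(m) : residues a < m coprime to m.
InU : ℕ → ℕ → Set
InU m a = a < m × Coprime a m

legendre : ℕ → ℕ → ℤ
legendre a zero = + 0
legendre a (suc q) with suc q ∣? a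
... | yes _ = + 0
... | no _ with any? (λ x → ((x ℕ.* x) % suc q) ≟ (a % suc q)) (upTo (suc q))
...   | yes _ = + 1
...   | no _  = - (+ 1)

-- multiplicity of p in n (for prime p and n ≥ 1): the number of k ∈ {1,…,n}
-- with p^k ∣ n.
mult : ℕ → ℕ → ℕ
mult p n = length (filter (λ k → (p ℕ.^ suc k) ∣? n) (upTo n))

jacobiFactor : ℕ → ℕ → ℕ → ℤ
jacobiFactor a n p with prime? p
... | yes _ = legendre a p ^ mult p n
... | no _  = + 1

-- Jacobi symbol (a/n) = ∏_{p prime, p ≤ n} (a/p)^{v_p(n)} = ∏_{p^r ∥ n} (a/p)^r
jacobi : ℕ → ℕ → ℤ
jacobi a n = foldr (λ p acc → jacobiFactor a n p * acc) (+ 1) (upTo (suc n))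

InS : ℕ → ℕ → Set
InS n a = InU n a × jacobi a n ≡ + 1

Odd : ℕ → Set
Odd n = ¬ (2 ∣ n)

IsSquare : ℕ → Set
IsSquare d = Σ ℕ (λ k → k ℕ.* k ≡ d)

-- Since d is not a square, some prime p divides d to an odd power v; write d = p^v m with
-- p ∤ m.  Given b ∈ U(n'), let ε = (b/n') = ±1 and choose c with (c/p) = ε (c = 1, or a
-- quadratic nonresidue mod p).  By the Chinese remainder theorem there is a with a ≡ c mod p,
-- a ≡ 1 mod m and a ≡ b mod n'.  The Jacobi symbol is multiplicative in the modulus and
-- depends on a only modulo the modulus, so (a/n) = (c/p)^v (1/m) (b/n') = ε^(v+1) = 1.
module Submission where

open import Defs
open import Data.Fin as Fin using (Fin; toℕ; fromℕ<)
import Data.Fin.Properties as Fin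
open import Data.Integer as ℤ using (ℤ; 0ℤ; 1ℤ; -1ℤ)
import Data.Integer.Properties as ℤ
open import Algebra.Properties.CommutativeSemigroup ℤ.*-commutativeSemigroup using (interchange)
open import Data.List using (List; []; _∷_; _∷ʳ_; filter; length; applyUpTo; upTo; foldr)
open import Data.List.Membership.Propositional using (_∈_)
open import Data.List.Membership.Propositional.Properties using (∈-upTo⁻)
open import Data.List.Properties using (upTo-∷ʳ)
open import Data.List.Relation.Unary.All using (_∷_)
open import Data.List.Relation.Unary.Any using (here; there; any?)
open import Data.List.Relation.Unary.Any.Properties using (applyUpTo⁺; applyUpTo⁻)
open import Data.Nat as ℕ
  using (ℕ; zero; suc; _+_; _*_; _^_; _%_; _<_; _≤_; _⊓_; z≤n; s≤s; z<s; s<s; NonZero; >-nonZero)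
import Data.Nat.Properties as ℕ
open import Data.Nat.Coprimality as Coprime using (Coprime; prime⇒coprime)
open import Data.Nat.Divisibility
open import Data.Nat.DivMod
  using (m%n<n; m%n%n≡m%n; m<n⇒m%n≡m; [m+kn]%n≡m%n; m∣n⇒o%n%m≡o%m; %-distribˡ-*; %-remove-+ˡ; %-remove-+ʳ)
open import Data.Nat.GCD using (module Bézout)
open import Data.Nat.Induction using (<-wellFounded)
open import Data.Nat.ListAction using (product)
open import Data.Nat.Primality
  using (Prime; prime?; euclidsLemma; prime⇒irreducible; prime⇒nonTrivial; prime⇒nonZero; ¬prime[1])
open import Data.Nat.Primality.Factorisation using (factorise)
open import Data.Nat.Tactic.RingSolver using (solve-∀)
open import Data.Product using (Σ; ∃; ∃₂; ∃-syntax; _×_; _,_; proj₁; proj₂)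
open import Data.Sum using (_⊎_; inj₁; inj₂; [_,_]′)
open import Function using (_∘_; id; flip)
open import Induction.WellFounded using (Acc; acc)
open import Level using (0ℓ)
open import Relation.Binary.PropositionalEquality
open import Relation.Nullary using (¬_; yes; no; contradiction)
open import Relation.Unary using (Pred; Decidable)

prime⇒1< : ∀ {p} → Prime p → 1 < p
prime⇒1< {p} p-prime = ℕ.nonTrivial⇒n>1 p {{prime⇒nonTrivial p-prime}}

∤⇒nonZero : ∀ {p x} → ¬ p ∣ x → NonZero x
∤⇒nonZero {p} p∤x = ℕ.≢-nonZero λ { refl → p∤x (p ∣0) }

odd⇒nonZero : ∀ {v} → Odd v → NonZero v
odd⇒nonZero v-odd = ℕ.≢-nonZero λ { refl → v-odd (2 ∣0) }

m∣m^n : ∀ m n .{{_ : NonZero n}} → m ∣ m ^ n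
m∣m^n m (suc n) = m∣m*n (m ^ n)

^-monoʳ-∣ : ∀ p {i j} → i ≤ j → p ^ i ∣ p ^ j
^-monoʳ-∣ p {i} i≤j with k , refl ← ℕ.m≤n⇒∃[o]m+o≡n i≤j =
  subst (p ^ i ∣_) (sym (ℕ.^-distribˡ-+-* p i k)) (m∣m*n (p ^ k))

n<m^n : ∀ {m} n → 1 < m → n < m ^ n
n<m^n zero    _   = z<s
n<m^n {m} (suc n) 1<m = begin-strict
  suc n             <⟨ ℕ.+-monoʳ-< 1 (n<m^n n 1<m) ⟩
  1 + m ^ n         ≤⟨ ℕ.+-monoˡ-≤ (m ^ n) (ℕ.≤-trans (s≤s z≤n) (n<m^n n 1<m)) ⟩
  m ^ n + m ^ n     ≡⟨ cong (m ^ n +_) (sym (ℕ.+-identityʳ (m ^ n))) ⟩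
  2 * m ^ n         ≤⟨ ℕ.*-monoˡ-≤ (m ^ n) 1<m ⟩
  m * m ^ n         ∎
  where open ℕ.≤-Reasoning

prime∣prime⇒≡ : ∀ {p q} → Prime q → Prime p → q ∣ p → q ≡ p
prime∣prime⇒≡ q-prime p-prime q∣p with prime⇒irreducible p-prime q∣p
... | inj₁ refl = contradiction q-prime ¬prime[1]
... | inj₂ q≡p  = q≡p

prime∣^⇒∣ : ∀ {p q} v → Prime q → q ∣ p ^ v → q ∣ p
prime∣^⇒∣ zero    q-prime q∣1 = contradiction (subst Prime (∣1⇒≡1 q∣1) q-prime) ¬prime[1]
prime∣^⇒∣ {p} (suc v) q-prime q∣p*p^v with euclidsLemma p (p ^ v) q-prime q∣p*p^v
... | inj₁ q∣p   = q∣p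
... | inj₂ q∣p^v = prime∣^⇒∣ v q-prime q∣p^v

prime∤⇒coprime : ∀ {p m} → Prime p → ¬ p ∣ m → Coprime p m
prime∤⇒coprime p-prime p∤m {i} (i∣p , i∣m) with prime⇒irreducible p-prime i∣p
... | inj₁ i≡1 = i≡1
... | inj₂ i≡p = contradiction (subst (_∣ _) i≡p i∣m) p∤m

∃-prime-divisor : ∀ x → 1 < x → ∃[ p ] Prime p × p ∣ x
∃-prime-divisor x@(suc _) 1<x with factorise x
... | record { factors = [] ; isFactorisation = x≡1 } = contradiction x≡1 (ℕ.>⇒≢ 1<x)
... | record { factors = p ∷ ps ; isFactorisation = x≡p*Πps ; factorsPrime = p-prime ∷ _ } =
  p , p-prime , subst (p ∣_) (sym x≡p*Πps) (m∣m*n (product ps))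

2∣-or-2∣suc : ∀ v → 2 ∣ v ⊎ 2 ∣ suc v
2∣-or-2∣suc zero    = inj₁ (2 ∣0)
2∣-or-2∣suc (suc v) with 2∣-or-2∣suc v
... | inj₁ 2∣v   = inj₂ (∣m∣n⇒∣m+n ∣-refl 2∣v)
... | inj₂ 2∣1+v = inj₁ 2∣1+v

odd⇒2∣suc : ∀ {v} → Odd v → 2 ∣ suc v
odd⇒2∣suc {v} v-odd with 2∣-or-2∣suc v
... | inj₁ 2∣v   = contradiction 2∣v v-odd
... | inj₂ 2∣1+v = 2∣1+v

odd⇒≡suc-double : ∀ {v} → Odd v → ∃[ h ] v ≡ suc (h + h)
odd⇒≡suc-double v-odd with odd⇒2∣suc v-odd
... | divides (suc h) 1+v≡[1+h]*2 = h , ℕ.suc-injective (trans 1+v≡[1+h]*2 (double h))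
  where
  double : ∀ h → suc h * 2 ≡ suc (suc (h + h))
  double = solve-∀

%-cong-∣ : ∀ {d n a b} .{{_ : NonZero d}} .{{_ : NonZero n}} → d ∣ n → a % n ≡ b % n → a % d ≡ b % d
%-cong-∣ {d} {n} {a} {b} d∣n a≡b = begin
  a % d      ≡⟨ m∣n⇒o%n%m≡o%m d n a d∣n ⟨
  a % n % d  ≡⟨ cong (_% d) a≡b ⟩
  b % n % d  ≡⟨ m∣n⇒o%n%m≡o%m d n b d∣n ⟩
  b % d      ∎
  where open ≡-Reasoning

%-*-≡1ʳ : ∀ {K} .{{_ : NonZero K}} r {w} → w % K ≡ 1 % K → r * w % K ≡ r % K
%-*-≡1ʳ {K} r {w} w≡1 = begin
  r * w % K                ≡⟨ %-distribˡ-* r w K ⟩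
  (r % K) * (w % K) % K    ≡⟨ cong (λ z → (r % K) * z % K) w≡1 ⟩
  (r % K) * (1 % K) % K    ≡⟨ %-distribˡ-* r 1 K ⟨
  r * 1 % K                ≡⟨ cong (_% K) (ℕ.*-identityʳ r) ⟩
  r % K                    ∎
  where open ≡-Reasoning

coprime-cong : ∀ {a c n} .{{_ : NonZero n}} → a % n ≡ c % n → Coprime c n → Coprime a n
coprime-cong a≡c c⊥n (i∣a , i∣n) = c⊥n (∣n∣m%n⇒∣m i∣n (subst (_ ∣_) a≡c (%-presˡ-∣ i∣a i∣n)) , i∣n)

coprime-* : ∀ {a x y} → Coprime a x → Coprime a y → Coprime a (x * y)
coprime-* {a} {x} a⊥x a⊥y {i} (i∣a , i∣x*y) = a⊥y (i∣a , Coprime.coprime-divisor i⊥x i∣x*y)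
  where
  i⊥x : Coprime i x
  i⊥x (j∣i , j∣x) = a⊥x (∣-trans j∣i i∣a , j∣x)

coprime-^ : ∀ {a x} → Coprime a x → ∀ k → Coprime a (x ^ k)
coprime-^ a⊥x zero    (_ , i∣1) = ∣1⇒≡1 i∣1
coprime-^ a⊥x (suc k) = coprime-* a⊥x (coprime-^ a⊥x k)

coprime⇒∃multiple≡1 : ∀ {M} N .{{_ : NonZero N}} → Coprime M N → ∃[ u ] M ∣ u × u % N ≡ 1 % N
coprime⇒∃multiple≡1 {M} N M⊥N with Coprime.coprime-Bézout M⊥N
... | Bézout.+- x y 1+yN≡xM = x * M , n∣m*n x , trans (cong (_% N) (sym 1+yN≡xM)) ([m+kn]%n≡m%n 1 y N)
coprime⇒∃multiple≡1 {M} N@(suc N₀) M⊥N | Bézout.-+ x y 1+xM≡yN =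
  x * M * N₀ , ∣m⇒∣m*n N₀ (n∣m*n x) , (begin
    x * M * N₀ % N                   ≡⟨ [m+kn]%n≡m%n (x * M * N₀) y N ⟨
    (x * M * N₀ + y * N) % N         ≡⟨ cong (λ z → (x * M * N₀ + z) % N) 1+xM≡yN ⟨
    (x * M * N₀ + (1 + x * M)) % N   ≡⟨ cong (_% N) (regroup (x * M) N₀) ⟩
    (1 + x * M * N) % N              ≡⟨ [m+kn]%n≡m%n 1 (x * M) N ⟩
    1 % N                            ∎)
  where
  open ≡-Reasoning
  regroup : ∀ k N₀ → k * N₀ + (1 + k) ≡ 1 + k * suc N₀
  regroup = solve-∀

crt : ∀ {M N} .{{_ : NonZero M}} .{{_ : NonZero N}} → Coprime M N →
      ∀ r s → ∃[ a ] a % M ≡ r % M × a % N ≡ s % N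
crt {M} {N} M⊥N r s
  with u , M∣u , u≡1 ← coprime⇒∃multiple≡1 N M⊥N
     | w , N∣w , w≡1 ← coprime⇒∃multiple≡1 M (Coprime.sym M⊥N) =
  r * w + s * u ,
  trans (%-remove-+ʳ (r * w) (∣n⇒∣m*n s M∣u)) (%-*-≡1ʳ r w≡1) ,
  trans (%-remove-+ˡ (s * u) (∣n⇒∣m*n r N∣w)) (%-*-≡1ʳ s u≡1)

-- Multiplicity of a prime

length-filter-applyUpTo : ∀ {ℓ} {P : Pred ℕ ℓ} (P? : Decidable P) f v N →
  (∀ i → P (f i) → i < v) → (∀ i → i < v → P (f i)) →
  length (filter P? (applyUpTo f N)) ≡ N ⊓ v
length-filter-applyUpTo P? f v zero    _    _  = refl
length-filter-applyUpTo P? f v (suc N) P⇒< <⇒P with P? (f 0) | v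
... | yes Pf0 | zero   = contradiction (P⇒< 0 Pf0) λ ()
... | yes _   | suc v′ = cong suc (length-filter-applyUpTo P? (f ∘ suc) v′ N
                           (λ i → ℕ.≤-pred ∘ P⇒< (suc i)) (λ i → <⇒P (suc i) ∘ s<s))
... | no ¬Pf0 | suc _  = contradiction (<⇒P 0 z<s) ¬Pf0
... | no _    | zero   = trans (length-filter-applyUpTo P? (f ∘ suc) 0 N
                           (λ i → flip contradiction ℕ.n≮0 ∘ P⇒< (suc i)) (λ _ ())) (ℕ.⊓-zeroʳ N)

mult[p^v*m]≡v : ∀ {p} v {m} → 1 < p → ¬ p ∣ m → mult p (p ^ v * m) ≡ v
mult[p^v*m]≡v {p} v {m} 1<p p∤m =
  trans (length-filter-applyUpTo _ id v (p ^ v * m) ∣⇒<v <v⇒∣) (ℕ.m≥n⇒m⊓n≡n v≤p^v*m)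
  where
  instance
    _ = >-nonZero (ℕ.<-trans z<s 1<p)
    _ = ℕ.m^n≢0 p v
  ∣⇒<v : ∀ i → p ^ suc i ∣ p ^ v * m → i < v
  ∣⇒<v i p^[1+i]∣p^v*m with i ℕ.<? v
  ... | yes i<v = i<v
  ... | no i≮v  = contradiction (*-cancelˡ-∣ (p ^ v) p^v*p∣p^v*m) p∤m
    where
    p^v*p∣p^v*m : p ^ v * p ∣ p ^ v * m
    p^v*p∣p^v*m = subst (_∣ p ^ v * m) (ℕ.*-comm p (p ^ v))
                    (∣-trans (^-monoʳ-∣ p (s≤s (ℕ.≮⇒≥ i≮v))) p^[1+i]∣p^v*m)
  <v⇒∣ : ∀ i → i < v → p ^ suc i ∣ p ^ v * m
  <v⇒∣ i i<v = ∣m⇒∣m*n m (^-monoʳ-∣ p i<v)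
  v≤p^v*m : v ≤ p ^ v * m
  v≤p^v*m = ℕ.≤-trans (ℕ.<⇒≤ (n<m^n v 1<p)) (ℕ.m≤m*n (p ^ v) m)
    where instance _ = ∤⇒nonZero p∤m

factor-out-powers : ∀ {p} → 1 < p → ∀ x → .{{NonZero x}} → ∃₂ λ v m → x ≡ p ^ v * m × ¬ p ∣ m
factor-out-powers {p} 1<p x = go x (<-wellFounded x)
  where
  go : ∀ x → .{{NonZero x}} → Acc _<_ x → ∃₂ λ v m → x ≡ p ^ v * m × ¬ p ∣ m
  go x (acc smaller) with p ∣? x
  ... | no p∤x = 0 , x , sym (ℕ.+-identityʳ x) , p∤x
  ... | yes p∣x@(divides q refl)
    with v , m , refl , p∤m ← go q {{quotient≢0 p∣x}} (smaller (ℕ.m<m*n q p {{quotient≢0 p∣x}} 1<p)) =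
    suc v , m , rotate (p ^ v) m p , p∤m
    where
    rotate : ∀ a b c → a * b * c ≡ c * a * b
    rotate = solve-∀

∤⇒mult≡0 : ∀ {p x} → 1 < p → ¬ p ∣ x → mult p x ≡ 0
∤⇒mult≡0 {p} {x} 1<p p∤x = subst (λ y → mult p y ≡ 0) (ℕ.+-identityʳ x) (mult[p^v*m]≡v 0 1<p p∤x)

mult-* : ∀ {p} x y .{{_ : NonZero x}} .{{_ : NonZero y}} → Prime p → mult p (x * y) ≡ mult p x + mult p y
mult-* {p} x y p-prime
  with u , r , refl , p∤r ← factor-out-powers (prime⇒1< p-prime) x
     | s , t , refl , p∤t ← factor-out-powers (prime⇒1< p-prime) y = begin
  mult p (p ^ u * r * (p ^ s * t))        ≡⟨ cong (mult p) (regroup (p ^ u) r (p ^ s) t) ⟩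
  mult p (p ^ u * p ^ s * (r * t))        ≡⟨ cong (λ z → mult p (z * (r * t))) (ℕ.^-distribˡ-+-* p u s) ⟨
  mult p (p ^ (u + s) * (r * t))          ≡⟨ mult[p^v*m]≡v (u + s) 1<p p∤r*t ⟩
  u + s                                   ≡⟨ cong₂ _+_ (mult[p^v*m]≡v u 1<p p∤r) (mult[p^v*m]≡v s 1<p p∤t) ⟨
  mult p (p ^ u * r) + mult p (p ^ s * t) ∎
  where
  open ≡-Reasoning
  1<p : 1 < p
  1<p = prime⇒1< p-prime
  regroup : ∀ a b c d → a * b * (c * d) ≡ a * c * (b * d)
  regroup = solve-∀
  p∤r*t : ¬ p ∣ r * t
  p∤r*t = [ p∤r , p∤t ]′ ∘ euclidsLemma r t p-prime

square-or-odd-mult : ∀ d → .{{NonZero d}} → IsSquare d ⊎ ∃[ p ] Prime p × Odd (mult p d)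
square-or-odd-mult d = go d (<-wellFounded d)
  where
  go : ∀ d → .{{NonZero d}} → Acc _<_ d → IsSquare d ⊎ ∃[ p ] Prime p × Odd (mult p d)
  go 1 _ = inj₁ (1 , refl)
  go d@(suc (suc _)) (acc smaller)
    with p , p-prime , p∣d ← ∃-prime-divisor d (s<s (s<s z≤n))
    with v , m , d≡p^v*m , p∤m ← factor-out-powers (prime⇒1< p-prime) d
    with 2 ∣? v
  ... | no v-odd = inj₂ (p , p-prime , subst Odd (sym mult-p-d) v-odd)
    where
    mult-p-d : mult p d ≡ v
    mult-p-d = trans (cong (mult p) d≡p^v*m) (mult[p^v*m]≡v v (prime⇒1< p-prime) p∤m)
  ... | yes (divides w refl) with go m {{∤⇒nonZero p∤m}} (smaller m<d)
    where
    m<d : m < d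
    m<d = ℕ.≤∧≢⇒< (∣⇒≤ (subst (m ∣_) (sym d≡p^v*m) (n∣m*n (p ^ (w * 2))))) λ { refl → p∤m p∣d }
  ...   | inj₁ (s , refl) = inj₁ (p ^ w * s , sym (trans d≡p^v*m p^[w*2]*s²≡[p^w*s]²))
    where
    square : ∀ x s → x * (x * 1) * (s * s) ≡ x * s * (x * s)
    square = solve-∀
    p^[w*2]*s²≡[p^w*s]² : p ^ (w * 2) * (s * s) ≡ p ^ w * s * (p ^ w * s)
    p^[w*2]*s²≡[p^w*s]² = trans (cong (_* (s * s)) (sym (ℕ.^-*-assoc p w 2))) (square (p ^ w) s)
  ...   | inj₂ (q , q-prime , mult-q-m-odd) = inj₂ (q , q-prime , subst Odd (sym mult-q-d) mult-q-m-odd)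
    where
    instance
      _ = ∤⇒nonZero p∤m
      _ = ℕ.m^n≢0 p (w * 2) {{prime⇒nonZero p-prime}}
    q∣m : q ∣ m
    q∣m with q ∣? m
    ... | yes q∣m = q∣m
    ... | no q∤m  = contradiction (subst (2 ∣_) (sym (∤⇒mult≡0 (prime⇒1< q-prime) q∤m)) (2 ∣0)) mult-q-m-odd
    q∤p^v : ¬ q ∣ p ^ (w * 2)
    q∤p^v q∣p^v = p∤m (subst (_∣ m) (prime∣prime⇒≡ q-prime p-prime (prime∣^⇒∣ (w * 2) q-prime q∣p^v)) q∣m)
    mult-q-d : mult q d ≡ mult q m
    mult-q-d = begin
      mult q d                             ≡⟨ cong (mult q) d≡p^v*m ⟩
      mult q (p ^ (w * 2) * m)             ≡⟨ mult-* (p ^ (w * 2)) m q-prime ⟩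
      mult q (p ^ (w * 2)) + mult q m      ≡⟨ cong (_+ mult q m) (∤⇒mult≡0 (prime⇒1< q-prime) q∤p^v) ⟩
      mult q m                             ∎
      where open ≡-Reasoning

nonsquare⇒odd-prime-power : ∀ d .{{_ : NonZero d}} → ¬ IsSquare d →
  ∃[ p ] ∃[ v ] ∃[ m ] Prime p × Odd v × ¬ p ∣ m × d ≡ p ^ v * m
nonsquare⇒odd-prime-power d ¬square with square-or-odd-mult d
... | inj₁ square = contradiction square ¬square
... | inj₂ (p , p-prime , mult-odd) with v , m , refl , p∤m ← factor-out-powers (prime⇒1< p-prime) d =
  p , v , m , p-prime , subst Odd (mult[p^v*m]≡v v (prime⇒1< p-prime) p∤m) mult-odd , p∤m , refl

-- jacobi a n is, by definition, ∏ (jacobiFactor a n) (upTo (suc n)).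
∏ : (ℕ → ℤ) → List ℕ → ℤ
∏ g = foldr (λ q acc → g q ℤ.* acc) 1ℤ

module _ {g h : ℕ → ℤ} where

  ∏-cong : (∀ q → g q ≡ h q) → ∀ xs → ∏ g xs ≡ ∏ h xs
  ∏-cong g≗h []       = refl
  ∏-cong g≗h (x ∷ xs) = cong₂ ℤ._*_ (g≗h x) (∏-cong g≗h xs)

  ∏-* : ∀ xs → ∏ (λ q → g q ℤ.* h q) xs ≡ ∏ g xs ℤ.* ∏ h xs
  ∏-* []       = refl
  ∏-* (x ∷ xs) = trans (cong (g x ℤ.* h x ℤ.*_) (∏-* xs)) (interchange (g x) (h x) (∏ g xs) (∏ h xs))

∏-∷ʳ : ∀ g xs x → ∏ g (xs ∷ʳ x) ≡ ∏ g xs ℤ.* g x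
∏-∷ʳ g []       x = ℤ.*-comm (g x) 1ℤ
∏-∷ʳ g (y ∷ xs) x = trans (cong (g y ℤ.*_) (∏-∷ʳ g xs x)) (sym (ℤ.*-assoc (g y) (∏ g xs) (g x)))

∏-closed : ∀ {ℓ} (P : Pred ℤ ℓ) → P 1ℤ → (∀ {i j} → P i → P j → P (i ℤ.* j)) →
           ∀ {g} xs → (∀ {q} → q ∈ xs → P (g q)) → P (∏ g xs)
∏-closed P P1 P* []       _   = P1
∏-closed P P1 P* (x ∷ xs) Pxs = P* (Pxs (here refl)) (∏-closed P P1 P* xs (Pxs ∘ there))

∏-≡1 : ∀ {g} xs → (∀ {q} → q ∈ xs → g q ≡ 1ℤ) → ∏ g xs ≡ 1ℤ
∏-≡1 = ∏-closed (_≡ 1ℤ) refl λ { refl refl → refl }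

data IsUnit : Pred ℤ 0ℓ where
  1ℤ-unit  : IsUnit 1ℤ
  -1ℤ-unit : IsUnit -1ℤ

IsUnit-* : ∀ {i j} → IsUnit i → IsUnit j → IsUnit (i ℤ.* j)
IsUnit-* 1ℤ-unit  1ℤ-unit  = 1ℤ-unit
IsUnit-* 1ℤ-unit  -1ℤ-unit = -1ℤ-unit
IsUnit-* -1ℤ-unit 1ℤ-unit  = -1ℤ-unit
IsUnit-* -1ℤ-unit -1ℤ-unit = 1ℤ-unit

IsUnit-^ : ∀ {i} → IsUnit i → ∀ k → IsUnit (i ℤ.^ k)
IsUnit-^ _      zero    = 1ℤ-unit
IsUnit-^ i-unit (suc k) = IsUnit-* i-unit (IsUnit-^ i-unit k)

IsUnit⇒i*i≡1 : ∀ {i} → IsUnit i → i ℤ.* i ≡ 1ℤ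
IsUnit⇒i*i≡1 1ℤ-unit  = refl
IsUnit⇒i*i≡1 -1ℤ-unit = refl

IsUnit⇒i^even≡1 : ∀ {i} → IsUnit i → ∀ {k} → 2 ∣ k → i ℤ.^ k ≡ 1ℤ
IsUnit⇒i^even≡1 {i} i-unit (divides k refl) = begin
  i ℤ.^ (k * 2)                    ≡⟨ ℤ.^-*-assoc i k 2 ⟨
  i ℤ.^ k ℤ.* (i ℤ.^ k ℤ.* 1ℤ)     ≡⟨ cong (i ℤ.^ k ℤ.*_) (ℤ.*-identityʳ (i ℤ.^ k)) ⟩
  i ℤ.^ k ℤ.* i ℤ.^ k              ≡⟨ IsUnit⇒i*i≡1 (IsUnit-^ i-unit k) ⟩
  1ℤ                               ∎
  where open ≡-Reasoning

-- The Legendre symbol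

data LegendreView (a p : ℕ) .{{_ : NonZero p}} : ℤ → Set where
  divisible  : p ∣ a → LegendreView a p 0ℤ
  residue    : ¬ p ∣ a → ∃[ x ] x < p × x * x % p ≡ a % p → LegendreView a p 1ℤ
  nonresidue : ¬ p ∣ a → (∀ x → x < p → x * x % p ≢ a % p) → LegendreView a p -1ℤ

legendre-view : ∀ a p .{{_ : NonZero p}} → LegendreView a p (legendre a p)
legendre-view a p@(suc _) with p ∣? a
... | yes p∣a = divisible p∣a
... | no p∤a with any? (λ x → ((x * x) % p) ℕ.≟ (a % p)) (upTo p)
...   | yes root = residue p∤a (applyUpTo⁻ id root)
...   | no ¬root = nonresidue p∤a λ x x<p x²≡a → ¬root (applyUpTo⁺ id x²≡a x<p)

module _ {p} .{{_ : NonZero p}} where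

  ∣-resp-% : ∀ {a b} → a % p ≡ b % p → p ∣ a → p ∣ b
  ∣-resp-% {a} {b} a≡b p∣a = m%n≡0⇒n∣m b p (trans (sym a≡b) (n∣m⇒m%n≡0 a p p∣a))

  legendre-cong : ∀ {a b} → a % p ≡ b % p → legendre a p ≡ legendre b p
  legendre-cong {a} {b} a≡b
    with legendre a p | legendre-view a p | legendre b p | legendre-view b p
  ... | _ | divisible _      | _ | divisible _      = refl
  ... | _ | residue _ _      | _ | residue _ _      = refl
  ... | _ | nonresidue _ _   | _ | nonresidue _ _   = refl
  ... | _ | divisible p∣a    | _ | residue p∤b _    = contradiction (∣-resp-% a≡b p∣a) p∤b
  ... | _ | divisible p∣a    | _ | nonresidue p∤b _ = contradiction (∣-resp-% a≡b p∣a) p∤b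
  ... | _ | residue p∤a _    | _ | divisible p∣b    = contradiction (∣-resp-% (sym a≡b) p∣b) p∤a
  ... | _ | nonresidue p∤a _ | _ | divisible p∣b    = contradiction (∣-resp-% (sym a≡b) p∣b) p∤a
  ... | _ | residue _ (x , x<p , x²≡a) | _ | nonresidue _ nonroot =
    contradiction (trans x²≡a a≡b) (nonroot x x<p)
  ... | _ | nonresidue _ nonroot | _ | residue _ (x , x<p , x²≡b) =
    contradiction (trans x²≡b (sym a≡b)) (nonroot x x<p)

  legendre-1 : 1 < p → legendre 1 p ≡ 1ℤ
  legendre-1 1<p with legendre 1 p | legendre-view 1 p
  ... | _ | divisible p∣1        = contradiction (∣1⇒≡1 p∣1) (ℕ.>⇒≢ 1<p)
  ... | _ | residue _ _          = refl
  ... | _ | nonresidue _ nonroot = contradiction refl (nonroot 1 1<p)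

  legendre-unit : ∀ {a} → ¬ p ∣ a → IsUnit (legendre a p)
  legendre-unit {a} p∤a with legendre a p | legendre-view a p
  ... | _ | divisible p∣a  = contradiction p∣a p∤a
  ... | _ | residue _ _    = 1ℤ-unit
  ... | _ | nonresidue _ _ = -1ℤ-unit

  residue-or-nonresidue : ∀ {a} → ¬ p ∣ a → (∃[ x ] x < p × x * x % p ≡ a % p) ⊎ legendre a p ≡ -1ℤ
  residue-or-nonresidue {a} p∤a with legendre a p | legendre-view a p
  ... | _ | divisible p∣a  = contradiction p∣a p∤a
  ... | _ | residue _ root = inj₁ root
  ... | _ | nonresidue _ _ = inj₂ refl

module _ (h : ℕ) .{{_ : NonZero h}} where

  private
    p : ℕ
    p = suc (h + h)

  reflect-square : ∀ x r → x + r ≡ p → r * r % p ≡ x * x % p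
  reflect-square x r x+r≡p = begin
    r * r % p                             ≡⟨ [m+kn]%n≡m%n (r * r) (x + x) p ⟨
    (r * r + (x + x) * p) % p             ≡⟨ cong (λ z → (r * r + (x + x) * z) % p) x+r≡p ⟨
    (r * r + (x + x) * (x + r)) % p       ≡⟨ cong (_% p) (reflect x r) ⟩
    (x * x + (x + r) * (x + r)) % p       ≡⟨ cong (λ z → (x * x + z * z) % p) x+r≡p ⟩
    (x * x + p * p) % p                   ≡⟨ [m+kn]%n≡m%n (x * x) p p ⟩
    x * x % p                             ∎
    where
    open ≡-Reasoning
    reflect : ∀ x r → r * r + (x + x) * (x + r) ≡ x * x + (x + r) * (x + r)
    reflect = solve-∀

  square-root-≤-half : ∀ {x y} → x < p → x * x % p ≡ y % p → ¬ p ∣ y →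
                       ∃[ z ] z < h × suc z * suc z % p ≡ y % p
  square-root-≤-half {zero}  _ 0≡y p∤y = contradiction (m%n≡0⇒n∣m _ p (sym 0≡y)) p∤y
  square-root-≤-half {suc x} x<p x²≡y _ with suc x ℕ.≤? h
  ... | yes x<h = x , x<h , x²≡y
  ... | no x≰h with o , x+o≡p ← ℕ.m≤n⇒∃[o]m+o≡n x<p =
    o , o<h , trans (reflect-square (suc x) (suc o) (trans (ℕ.+-suc (suc x) o) x+o≡p)) x²≡y
    where
    o<h : o < h
    o<h = ℕ.+-cancelˡ-< h o h (begin-strict
      h + o      <⟨ ℕ.+-monoˡ-< o (ℕ.≰⇒> x≰h) ⟩
      suc x + o  ≡⟨ ℕ.suc-injective x+o≡p ⟩
      h + h      ∎)
      where open ℕ.≤-Reasoning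

  half-squares-miss : ¬ (∀ (i : Fin (h + h)) → ∃[ z ] z < h × suc z * suc z % p ≡ suc (toℕ i) % p)
  half-squares-miss root
    with i , j , i<j , same-root
           ← Fin.pigeonhole (ℕ.m<m+n h (ℕ.>-nonZero⁻¹ h)) (λ i → fromℕ< (proj₁ (proj₂ (root i)))) =
    Fin.<-irrefl (Fin.toℕ-injective (ℕ.suc-injective (begin
      suc (toℕ i)               ≡⟨ root-of i ⟩
      suc (z i) * suc (z i) % p ≡⟨ cong (λ w → suc w * suc w % p) z-same ⟩
      suc (z j) * suc (z j) % p ≡⟨ root-of j ⟨
      suc (toℕ j)               ∎))) i<j
    where
    open ≡-Reasoning
    z : Fin (h + h) → ℕ
    z = proj₁ ∘ root
    root-of : ∀ i → suc (toℕ i) ≡ suc (z i) * suc (z i) % p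
    root-of i = sym (trans (proj₂ (proj₂ (root i))) (m<n⇒m%n≡m (s<s (Fin.toℕ<n i))))
    z-same : z i ≡ z j
    z-same = trans (sym (Fin.toℕ-fromℕ< _)) (trans (cong toℕ same-root) (Fin.toℕ-fromℕ< _))

  -- If all 2h nonzero residues were squares then, as x and p ∸ x have the same square, each
  -- would be the square of one of 1, …, h, which the pigeonhole principle forbids.
  ∃-nonresidue : ∃[ y ] 0 < y × y < p × legendre y p ≡ -1ℤ
  ∃-nonresidue with Fin.any? (λ (i : Fin (h + h)) → legendre (suc (toℕ i)) p ℤ.≟ -1ℤ)
  ... | yes (i , i-nonresidue) = suc (toℕ i) , z<s , s<s (Fin.toℕ<n i) , i-nonresidue
  ... | no no-nonresidue       = contradiction root half-squares-miss
    where
    root : ∀ (i : Fin (h + h)) → ∃[ z ] z < h × suc z * suc z % p ≡ suc (toℕ i) % p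
    root i with residue-or-nonresidue (>⇒∤ (s<s (Fin.toℕ<n i)))
    ... | inj₁ (x , x<p , x²≡i) = square-root-≤-half x<p x²≡i (>⇒∤ (s<s (Fin.toℕ<n i)))
    ... | inj₂ i-nonresidue     = contradiction (i , i-nonresidue) no-nonresidue

legendre-onto-units : ∀ {p} → 1 < p → Odd p → ∀ {ε} → IsUnit ε → ∃[ c ] 0 < c × c < p × legendre c p ≡ ε
legendre-onto-units 1<p _ 1ℤ-unit = 1 , z<s , 1<p , legendre-1 {{>-nonZero (ℕ.<-trans z<s 1<p)}} 1<p
legendre-onto-units 1<p p-odd -1ℤ-unit with h , refl ← odd⇒≡suc-double p-odd =
  ∃-nonresidue h {{ℕ.≢-nonZero λ { refl → ℕ.<-irrefl refl 1<p }}}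

-- The Jacobi symbol

module _ (a n : ℕ) where

  jacobiFactor-trivial : ∀ {q} → (Prime q → ¬ q ∣ n) → jacobiFactor a n q ≡ 1ℤ
  jacobiFactor-trivial {q} q∤n with prime? q
  ... | no _        = refl
  ... | yes q-prime rewrite ∤⇒mult≡0 (prime⇒1< q-prime) (q∤n q-prime) = refl

  jacobi-upTo : .{{_ : NonZero n}} → ∀ {N} → n < N → ∏ (jacobiFactor a n) (upTo N) ≡ jacobi a n
  jacobi-upTo {suc N} (s≤s n≤N) with ℕ.m≤n⇒m<n∨m≡n n≤N
  ... | inj₂ refl = refl
  ... | inj₁ n<N  = begin
    ∏ (jacobiFactor a n) (upTo (suc N))                   ≡⟨ cong (∏ (jacobiFactor a n)) (upTo-∷ʳ N) ⟨
    ∏ (jacobiFactor a n) (upTo N ∷ʳ N)                    ≡⟨ ∏-∷ʳ (jacobiFactor a n) (upTo N) N ⟩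
    ∏ (jacobiFactor a n) (upTo N) ℤ.* jacobiFactor a n N  ≡⟨ cong₂ ℤ._*_ (jacobi-upTo n<N)
                                                               (jacobiFactor-trivial (λ _ → >⇒∤ n<N)) ⟩
    jacobi a n ℤ.* 1ℤ                                     ≡⟨ ℤ.*-identityʳ (jacobi a n) ⟩
    jacobi a n                                            ∎
    where open ≡-Reasoning

jacobiFactor-* : ∀ a x y .{{_ : NonZero x}} .{{_ : NonZero y}} q →
                 jacobiFactor a (x * y) q ≡ jacobiFactor a x q ℤ.* jacobiFactor a y q
jacobiFactor-* a x y q with prime? q
... | no _        = refl
... | yes q-prime = trans (cong (legendre a q ℤ.^_) (mult-* x y q-prime))
                          (ℤ.^-distribˡ-+-* (legendre a q) (mult q x) (mult q y))

jacobi-* : ∀ a x y .{{_ : NonZero x}} .{{_ : NonZero y}} → jacobi a (x * y) ≡ jacobi a x ℤ.* jacobi a y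
jacobi-* a x y = begin
  ∏ (jacobiFactor a (x * y)) U                            ≡⟨ ∏-cong (jacobiFactor-* a x y) U ⟩
  ∏ (λ q → jacobiFactor a x q ℤ.* jacobiFactor a y q) U   ≡⟨ ∏-* {jacobiFactor a x} {jacobiFactor a y} U ⟩
  ∏ (jacobiFactor a x) U ℤ.* ∏ (jacobiFactor a y) U       ≡⟨ cong₂ ℤ._*_ (jacobi-upTo a x (s≤s (ℕ.m≤m*n x y)))
                                                                         (jacobi-upTo a y (s≤s (ℕ.m≤n*m y x))) ⟩
  jacobi a x ℤ.* jacobi a y                               ∎
  where
  open ≡-Reasoning
  U : List ℕ
  U = upTo (suc (x * y))

jacobi-cong : ∀ {a b} n .{{_ : NonZero n}} → a % n ≡ b % n → jacobi a n ≡ jacobi b n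
jacobi-cong {a} {b} n a≡b = ∏-cong same-factor (upTo (suc n))
  where
  same-factor : ∀ q → jacobiFactor a n q ≡ jacobiFactor b n q
  same-factor q with prime? q | q ∣? n
  ... | no _        | _       = refl
  ... | yes q-prime | yes q∣n = cong (ℤ._^ mult q n) (legendre-cong {p = q} (%-cong-∣ q∣n a≡b))
    where instance _ = prime⇒nonZero q-prime
  ... | yes q-prime | no q∤n rewrite ∤⇒mult≡0 (prime⇒1< q-prime) q∤n = refl

jacobi-1 : ∀ n → jacobi 1 n ≡ 1ℤ
jacobi-1 n = ∏-≡1 (upTo (suc n)) (λ {q} _ → trivial q)
  where
  trivial : ∀ q → jacobiFactor 1 n q ≡ 1ℤ
  trivial q with prime? q
  ... | no _        = refl
  ... | yes q-prime = trans (cong (ℤ._^ mult q n) (legendre-1 {p = q} (prime⇒1< q-prime))) (ℤ.^-zeroˡ (mult q n))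
    where instance _ = prime⇒nonZero q-prime

jacobi-unit : ∀ {b} n → Coprime b n → IsUnit (jacobi b n)
jacobi-unit {b} n b⊥n = ∏-closed IsUnit 1ℤ-unit IsUnit-* (upTo (suc n)) (λ {q} _ → unit q)
  where
  unit : ∀ q → IsUnit (jacobiFactor b n q)
  unit q with prime? q | q ∣? n
  ... | no _        | _       = 1ℤ-unit
  ... | yes q-prime | yes q∣n = IsUnit-^ (legendre-unit {p = q} q∤b) (mult q n)
    where
    instance _ = prime⇒nonZero q-prime
    q∤b : ¬ q ∣ b
    q∤b q∣b = ¬prime[1] (subst Prime (b⊥n (q∣b , q∣n)) q-prime)
  ... | yes q-prime | no q∤n rewrite ∤⇒mult≡0 (prime⇒1< q-prime) q∤n = 1ℤ-unit

jacobi-prime : ∀ a {p} → Prime p → jacobi a p ≡ legendre a p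
jacobi-prime a {p} p-prime = begin
  ∏ (jacobiFactor a p) (upTo (suc p))                    ≡⟨ cong (∏ (jacobiFactor a p)) (upTo-∷ʳ p) ⟨
  ∏ (jacobiFactor a p) (upTo p ∷ʳ p)                     ≡⟨ ∏-∷ʳ (jacobiFactor a p) (upTo p) p ⟩
  ∏ (jacobiFactor a p) (upTo p) ℤ.* jacobiFactor a p p   ≡⟨ cong₂ ℤ._*_ below-p-trivial at-p ⟩
  1ℤ ℤ.* legendre a p                                    ≡⟨ ℤ.*-identityˡ (legendre a p) ⟩
  legendre a p                                           ∎
  where
  open ≡-Reasoning
  below-p-trivial : ∏ (jacobiFactor a p) (upTo p) ≡ 1ℤ
  below-p-trivial = ∏-≡1 (upTo p) λ q∈ →
    jacobiFactor-trivial a p λ q-prime q∣p → ℕ.<⇒≢ (∈-upTo⁻ q∈) (prime∣prime⇒≡ q-prime p-prime q∣p)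
  mult-p-p : mult p p ≡ 1
  mult-p-p = trans (cong (mult p) (sym (trans (ℕ.*-identityʳ (p * 1)) (ℕ.*-identityʳ p))))
                   (mult[p^v*m]≡v 1 (prime⇒1< p-prime) (>⇒∤ (prime⇒1< p-prime)))
  at-p : jacobiFactor a p p ≡ legendre a p
  at-p with prime? p
  ... | no ¬p-prime = contradiction p-prime ¬p-prime
  ... | yes _       = trans (cong (legendre a p ℤ.^_) mult-p-p) (ℤ.^-identityʳ (legendre a p))

jacobi-^ : ∀ a {p} → Prime p → ∀ v → jacobi a (p ^ v) ≡ legendre a p ℤ.^ v
jacobi-^ a p-prime zero    = refl
jacobi-^ a {p} p-prime (suc v) = begin
  jacobi a (p * p ^ v)              ≡⟨ jacobi-* a p (p ^ v) ⟩
  jacobi a p ℤ.* jacobi a (p ^ v)   ≡⟨ cong₂ ℤ._*_ (jacobi-prime a p-prime) (jacobi-^ a p-prime v) ⟩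
  legendre a p ℤ.^ suc v            ∎
  where
  open ≡-Reasoning
  instance
    _ = prime⇒nonZero p-prime
    _ = ℕ.m^n≢0 p v

jacobi-by-congruences : ∀ {p} .{{_ : NonZero p}} → Prime p → ∀ v {m n′} .{{_ : NonZero m}} .{{_ : NonZero n′}} {a b c} →
  a % p ≡ c % p → a % m ≡ 1 % m → a % n′ ≡ b % n′ →
  jacobi a (p ^ v * m * n′) ≡ legendre c p ℤ.^ v ℤ.* jacobi b n′
jacobi-by-congruences {p} p-prime v {m} {n′} {a} {b} {c} a≡c a≡1 a≡b = begin
  jacobi a (p ^ v * m * n′)                          ≡⟨ jacobi-* a (p ^ v * m) n′ ⟩
  jacobi a (p ^ v * m) ℤ.* jacobi a n′               ≡⟨ cong (ℤ._* jacobi a n′) (jacobi-* a (p ^ v) m) ⟩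
  jacobi a (p ^ v) ℤ.* jacobi a m ℤ.* jacobi a n′    ≡⟨ cong₂ ℤ._*_ (cong₂ ℤ._*_ at-p^v at-m) (jacobi-cong n′ a≡b) ⟩
  legendre c p ℤ.^ v ℤ.* 1ℤ ℤ.* jacobi b n′          ≡⟨ cong (ℤ._* jacobi b n′) (ℤ.*-identityʳ (legendre c p ℤ.^ v)) ⟩
  legendre c p ℤ.^ v ℤ.* jacobi b n′                 ∎
  where
  open ≡-Reasoning
  instance
    _ = ℕ.m^n≢0 p v
    _ = ℕ.m*n≢0 (p ^ v) m
  at-p^v : jacobi a (p ^ v) ≡ legendre c p ℤ.^ v
  at-p^v = trans (jacobi-^ a p-prime v) (cong (ℤ._^ v) (legendre-cong a≡c))
  at-m : jacobi a m ≡ 1ℤ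
  at-m = trans (jacobi-cong m a≡1) (jacobi-1 m)

in-kernel-by-congruences : ∀ {p v m n′ a b c} .{{_ : NonZero p}} .{{_ : NonZero m}} .{{_ : NonZero n′}} →
  Prime p → Odd v → Coprime b n′ → 0 < c → c < p → legendre c p ≡ jacobi b n′ →
  a % p ≡ c % p → a % m ≡ 1 % m → a % n′ ≡ b % n′ →
  Coprime a (p ^ v * m * n′) × jacobi a (p ^ v * m * n′) ≡ 1ℤ
in-kernel-by-congruences {p} {v} {m} {n′} {a} {b} {c} p-prime v-odd b⊥n′ 0<c c<p c-symbol a≡c a≡1 a≡b =
  coprime-* (coprime-* (coprime-^ a⊥p v) (coprime-cong a≡1 (Coprime.1-coprimeTo m))) (coprime-cong a≡b b⊥n′) ,
  (begin
    jacobi a (p ^ v * m * n′)              ≡⟨ jacobi-by-congruences p-prime v a≡c a≡1 a≡b ⟩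
    legendre c p ℤ.^ v ℤ.* jacobi b n′     ≡⟨ cong (λ x → x ℤ.^ v ℤ.* jacobi b n′) c-symbol ⟩
    jacobi b n′ ℤ.^ v ℤ.* jacobi b n′      ≡⟨ ℤ.*-comm (jacobi b n′ ℤ.^ v) (jacobi b n′) ⟩
    jacobi b n′ ℤ.^ suc v                  ≡⟨ IsUnit⇒i^even≡1 (jacobi-unit n′ b⊥n′) (odd⇒2∣suc v-odd) ⟩
    1ℤ                                     ∎)
  where
  open ≡-Reasoning
  a⊥p : Coprime a p
  a⊥p = coprime-cong a≡c (Coprime.sym (prime⇒coprime p-prime {{>-nonZero 0<c}} c<p))

∃-jacobi≡1-lift : ∀ {p v m n′ b} .{{_ : NonZero p}} .{{_ : NonZero m}} .{{_ : NonZero n′}} →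
  Prime p → Odd p → Odd v → ¬ p ∣ m → Coprime (p ^ v * m) n′ → Coprime b n′ →
  ∃[ a ] Coprime a (p ^ v * m * n′) × jacobi a (p ^ v * m * n′) ≡ 1ℤ × a % n′ ≡ b % n′
∃-jacobi≡1-lift {p} {v} {m} {n′} {b} p-prime p-odd v-odd p∤m p^vm⊥n′ b⊥n′ =
  let c , 0<c , c<p , c-symbol = legendre-onto-units (prime⇒1< p-prime) p-odd (jacobi-unit n′ b⊥n′)
      a₁ , a₁≡c , a₁≡1         = crt p^v⊥m c 1
      a , a≡a₁ , a≡b           = crt p^vm⊥n′ a₁ b
      a⊥n , jacobi-a≡1         = in-kernel-by-congruences p-prime v-odd b⊥n′ 0<c c<p c-symbol
                                   (trans (%-cong-∣ (∣m⇒∣m*n m p∣p^v) a≡a₁) (%-cong-∣ p∣p^v a₁≡c))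
                                   (trans (%-cong-∣ (n∣m*n (p ^ v)) a≡a₁) a₁≡1) a≡b
  in a , a⊥n , jacobi-a≡1 , a≡b
  where
  instance
    _ = ℕ.m^n≢0 p v
    _ = ℕ.m*n≢0 (p ^ v) m
  p∣p^v : p ∣ p ^ v
  p∣p^v = m∣m^n p v {{odd⇒nonZero v-odd}}
  p^v⊥m : Coprime (p ^ v) m
  p^v⊥m = Coprime.sym (coprime-^ (Coprime.sym (prime∤⇒coprime p-prime p∤m)) v)

canonical-representative : ∀ n {n′ b} .{{_ : NonZero n}} .{{_ : NonZero n′}} → n′ ∣ n → b < n′ →
  (∃[ a ] Coprime a n × jacobi a n ≡ 1ℤ × a % n′ ≡ b % n′) → Σ ℕ (λ a → InS n a × a % n′ ≡ b)
canonical-representative n n′∣n b<n′ (a , a⊥n , jacobi≡1 , a≡b) =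
  a % n , ((m%n<n a n , coprime-cong a%n≡a a⊥n) , trans (jacobi-cong n a%n≡a) jacobi≡1) ,
  trans (%-cong-∣ n′∣n a%n≡a) (trans a≡b (m<n⇒m%n≡m b<n′))
  where
  a%n≡a : a % n % n ≡ a % n
  a%n≡a = m%n%n≡m%n a n

lemma2p4 : (n d n' : ℕ) → .{{_ : NonZero n'}} → Odd n → n ≡ d * n' → ¬ (d ≡ n) → ¬ IsSquare d → Coprime d n' → (b : ℕ) → InU n' b → Σ ℕ (λ a → InS n a × a % n' ≡ b)
lemma2p4 n d n′ n-odd refl _ d-nonsquare d⊥n′ b (b<n′ , b⊥n′)
  with p , v , m , p-prime , v-odd , p∤m , refl
         ← nonsquare⇒odd-prime-power d {{ℕ.m*n≢0⇒m≢0 d {{odd⇒nonZero n-odd}}}} d-nonsquare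
  = canonical-representative n {{odd⇒nonZero n-odd}} (n∣m*n (p ^ v * m)) b<n′
      (∃-jacobi≡1-lift {{prime⇒nonZero p-prime}} {{∤⇒nonZero p∤m}} p-prime p-odd v-odd p∤m d⊥n′ b⊥n′)
  where
  p-odd : Odd p
  p-odd 2∣p = n-odd (∣-trans 2∣p (∣m⇒∣m*n n′ (∣m⇒∣m*n m (m∣m^n p v {{odd⇒nonZero v-odd}}))))
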